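{- Let $r,s\ge1$ and $p_1,\dots,p_r,q_1,\dots,q_s$ be positive integers with $\{p_i\}\cap\{q_j\}=\emptyset$, $q_s=1$ and $\sum_ip_i=\sum_jq_j$; put $n=r+s-1$, $S=\{0,\dots,n\}$, $P_0=p_r$, $P_i=p_i$ ($1\le i\le r-1$), $P_{r-1+j}=q_j$ ($1\le j\le s$), and let ${\bf e}_i$ be as in the context. Let $T$ be a nonempty proper subset of $S$ and $d_T=\gcd\{P_i:i\in S\setminus T\}$. If $v\in\mathbb Z^n$ and $v=\sum_{j\in T}a_j{\bf e}_j$ with all $a_j\ge0$, then $a_j\in\frac1{d_T}\mathbb Z$ for all $j\in T$.
   Context: ${\bf e}_0=[1,0,\dots,0]\in\mathbb Z^n$; for $1\le i\le n-1$, ${\bf e}_i$ has first coordinate $1$, $(i+1)$-st coordinate $1$, other coordinates $0$; ${\bf e}_n=[1,p_1,\dots,p_{r-1},-q_1,\dots,-q_{s-1}]$.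
   Formalization: The coefficients $a_j$ in the representation of v are taken to be rational. -}

module Defs where

open import Data.Nat using (ℕ; zero; suc; _+_; _∸_; _<?_; _≤ᵇ_; _≡ᵇ_; NonZero)
open import Data.Nat.GCD using (gcd)
open import Data.Integer using (ℤ; +_; -_)
open import Data.Rational using (ℚ; _/_; 0ℚ) renaming (_+_ to _+ℚ_)
open import Data.Fin using (Fin; toℕ; fromℕ<)
open import Data.Fin.Subset using (Subset)
open import Data.Vec using (lookup)
open import Data.List using (List; foldr; allFin)
open import Data.Bool using (Bool; if_then_else_)
open import Relation.Nullary using (yes; no)

-- Conventions: r = suc r', s = suc s' (so r, s ≥ 1).
-- p : Fin (suc r') → ℕ with p_i = p (i-1), q_j = q (j-1) (0-based Fin indices).
-- n = r + s - 1 = r' + suc s'.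

dim : ℕ → ℕ → ℕ
dim r' s' = r' + suc s'

-- safe ℕ-indexed lookup (default 0 outside range; never used out of range)
at : {m : ℕ} → (Fin m → ℕ) → ℕ → ℕ
at {m} f k with k <? m
... | yes k<m = f (fromℕ< k<m)
... | no _ = 0

-- P_k for k = 0..n : P_0 = p_r, P_k = p_k (1 ≤ k ≤ r-1), P_{r-1+j} = q_j (1 ≤ j ≤ s)
Pℕ : (r' s' : ℕ) → (Fin (suc r') → ℕ) → (Fin (suc s') → ℕ) → ℕ → ℕ
Pℕ r' s' p q zero = at p r'
Pℕ r' s' p q (suc k) = if suc k ≤ᵇ r' then at p k else at q (suc k ∸ suc r')

P : (r' s' : ℕ) → (Fin (suc r') → ℕ) → (Fin (suc s') → ℕ) → Fin (suc (dim r' s')) → ℕ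
P r' s' p q i = Pℕ r' s' p q (toℕ i)

-- the vectors e_0,...,e_n ∈ ℤ^n; coordinates are 0-based (coordinate c = paper's (c+1)-st)
-- e_0 = [1,0,...,0]; e_i (1≤i≤n-1): coordinate 0 and coordinate i equal 1;
-- e_n = [1, p_1,...,p_{r-1}, -q_1,...,-q_{s-1}]
eℕ : (r' s' : ℕ) → (Fin (suc r') → ℕ) → (Fin (suc s') → ℕ) → ℕ → ℕ → ℤ
eℕ r' s' p q i zero = + 1
eℕ r' s' p q i (suc c) =
  if i ≡ᵇ dim r' s'
  then (if suc c ≤ᵇ r' then + at p c else - (+ at q (suc c ∸ suc r')))
  else (if i ≡ᵇ suc c then + 1 else + 0)

e : (r' s' : ℕ) → (Fin (suc r') → ℕ) → (Fin (suc s') → ℕ) →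
    Fin (suc (dim r' s')) → Fin (dim r' s') → ℤ
e r' s' p q i c = eℕ r' s' p q (toℕ i) (toℕ c)

sumOver : {m : ℕ} → Subset m → (Fin m → ℚ) → ℚ
sumOver {m} T f = foldr (λ j acc → if lookup T j then f j +ℚ acc else acc) 0ℚ (allFin m)

-- gcd of g i over i ∉ T (gcd of the empty family is 0)
gcdOutside : {m : ℕ} → Subset m → (Fin m → ℕ) → ℕ
gcdOutside {m} T g = foldr (λ j acc → if lookup T j then acc else gcd (g j) acc) 0 (allFin m)

toℚ : ℤ → ℚ
toℚ k = k / 1

sumℕ : {m : ℕ} → (Fin m → ℕ) → ℕ
sumℕ {m} f = foldr (λ j acc → f j + acc) 0 (allFin m)

module Submission where

-- Put αₖ = aₖ for k ∈ T and αₖ = 0 otherwise, and t = αₙ. Coordinate c (1 ≤ c ≤ n-1) of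
-- v = Σₖ αₖ eₖ reads v_c = α_c ± t P_c, and coordinate 0, together with Σᵢ pᵢ = Σⱼ qⱼ,
-- gives α₀ + t P₀ = v₀ - Σ_{c≥1} v_c; finally αₙ = t Pₙ as Pₙ = q_s = 1. So every αₖ
-- agrees with ±t Pₖ modulo ℤ. For k ∉ T this says t Pₖ ∈ ℤ, hence t d_T ∈ ℤ by Bézout,
-- and then for j ∈ T also a_j d_T ≡ ±P_j (t d_T) ≡ 0 modulo ℤ.

open import Defs
open import Data.Bool using (true; false; T; if_then_else_)
open import Data.Empty using (⊥-elim)
import Data.Fin as Fin
open import Data.Fin using (Fin; toℕ; fromℕ<; fromℕ)
open import Data.Fin.Properties using (fromℕ<-toℕ; toℕ<n; toℕ-fromℕ<; toℕ-fromℕ)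
open import Data.Fin.Subset using (Subset; _∈_; _∉_; Nonempty)
open import Data.Integer as ℤ using (ℤ; +_)
import Data.Integer.Properties as ℤ
open import Data.List using (List; []; _∷_; foldr; allFin; tabulate)
open import Data.Nat as ℕ using (ℕ; zero; suc; _<_; _>_; _≤ᵇ_; _≡ᵇ_; _∸_; s≤s; z≤n)
import Data.Nat.Properties as ℕ
open import Data.Nat.GCD using (gcd; gcd-GCD; module Bézout)
open import Data.Product using (∃; ∃-syntax; _,_)
open import Data.Rational using (ℚ; 0ℚ; 1ℚ; _+_; _*_; _-_; -_; _≤_; toℚᵘ)
open import Data.Rational.Properties
  using (+-*-commutativeRing; _≟_; toℚᵘ-injective; toℚᵘ-fromℚᵘ; toℚᵘ-homo-+; toℚᵘ-homo-*; toℚᵘ-homo‿-;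
         +-identityˡ; +-identityʳ; +-assoc; +-comm; +-inverseʳ; neg-distrib-+;
         *-identityʳ; *-zeroˡ; *-zeroʳ; neg-distribʳ-*)
import Data.Rational.Unnormalised as ℚᵘ
import Data.Rational.Unnormalised.Properties as ℚᵘ
open import Data.Sum using (_⊎_; inj₁; inj₂)
open import Data.Vec using (lookup)
open import Data.Vec.Properties using ([]=⇒lookup)
open import Function using (_∘_; id)
open import Level using (0ℓ)
open import Relation.Nullary using (yes; no; ¬_)
open import Relation.Nullary.Decidable using (dec⇒maybe)
open import Relation.Binary.PropositionalEquality
open import Tactic.RingSolver using (solve-∀)
open import Tactic.RingSolver.Core.AlmostCommutativeRing using (AlmostCommutativeRing; fromCommutativeRing)

ℚ-ring : AlmostCommutativeRing 0ℓ 0ℓ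
ℚ-ring = fromCommutativeRing +-*-commutativeRing (λ x → dec⇒maybe (0ℚ ≟ x))

toℚᵘ-toℚ : ∀ k → toℚᵘ (toℚ k) ℚᵘ.≃ ℚᵘ.mkℚᵘ k 0
toℚᵘ-toℚ k = toℚᵘ-fromℚᵘ (ℚᵘ.mkℚᵘ k 0)

toℚ-+ : ∀ a b → toℚ (a ℤ.+ b) ≡ toℚ a + toℚ b
toℚ-+ a b = toℚᵘ-injective (begin
  toℚᵘ (toℚ (a ℤ.+ b))            ≈⟨ toℚᵘ-toℚ (a ℤ.+ b) ⟩
  ℚᵘ.mkℚᵘ (a ℤ.+ b) 0              ≈⟨ ℚᵘ.*≡* (cong (ℤ._* ℤ.1ℤ) (sym (cong₂ ℤ._+_ (ℤ.*-identityʳ a)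
                                                                                 (ℤ.*-identityʳ b)))) ⟩
  ℚᵘ.mkℚᵘ a 0 ℚᵘ.+ ℚᵘ.mkℚᵘ b 0     ≈⟨ ℚᵘ.+-cong (ℚᵘ.≃-sym (toℚᵘ-toℚ a)) (ℚᵘ.≃-sym (toℚᵘ-toℚ b)) ⟩
  toℚᵘ (toℚ a) ℚᵘ.+ toℚᵘ (toℚ b)   ≈⟨ ℚᵘ.≃-sym (toℚᵘ-homo-+ (toℚ a) (toℚ b)) ⟩
  toℚᵘ (toℚ a + toℚ b)            ∎)
  where open ℚᵘ.≃-Reasoning

toℚ-* : ∀ a b → toℚ (a ℤ.* b) ≡ toℚ a * toℚ b
toℚ-* a b = toℚᵘ-injective (begin
  toℚᵘ (toℚ (a ℤ.* b))            ≈⟨ toℚᵘ-toℚ (a ℤ.* b) ⟩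
  ℚᵘ.mkℚᵘ a 0 ℚᵘ.* ℚᵘ.mkℚᵘ b 0     ≈⟨ ℚᵘ.*-cong (ℚᵘ.≃-sym (toℚᵘ-toℚ a)) (ℚᵘ.≃-sym (toℚᵘ-toℚ b)) ⟩
  toℚᵘ (toℚ a) ℚᵘ.* toℚᵘ (toℚ b)   ≈⟨ ℚᵘ.≃-sym (toℚᵘ-homo-* (toℚ a) (toℚ b)) ⟩
  toℚᵘ (toℚ a * toℚ b)            ∎)
  where open ℚᵘ.≃-Reasoning

toℚ-neg : ∀ a → toℚ (ℤ.- a) ≡ - toℚ a
toℚ-neg a = toℚᵘ-injective (begin
  toℚᵘ (toℚ (ℤ.- a))              ≈⟨ toℚᵘ-toℚ (ℤ.- a) ⟩
  ℚᵘ.- ℚᵘ.mkℚᵘ a 0                 ≈⟨ ℚᵘ.-‿cong (ℚᵘ.≃-sym (toℚᵘ-toℚ a)) ⟩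
  ℚᵘ.- toℚᵘ (toℚ a)               ≈⟨ ℚᵘ.≃-sym (toℚᵘ-homo‿- (toℚ a)) ⟩
  toℚᵘ (- toℚ a)                  ∎)
  where open ℚᵘ.≃-Reasoning

ℚ[_] : ℕ → ℚ
ℚ[ n ] = toℚ (+ n)

ℚ[]-+ : ∀ m n → ℚ[ m ℕ.+ n ] ≡ ℚ[ m ] + ℚ[ n ]
ℚ[]-+ m n = trans (cong toℚ (ℤ.pos-+ m n)) (toℚ-+ (+ m) (+ n))

ℚ[]-* : ∀ m n → ℚ[ m ℕ.* n ] ≡ ℚ[ m ] * ℚ[ n ]
ℚ[]-* m n = trans (cong toℚ (ℤ.pos-* m n)) (toℚ-* (+ m) (+ n))

IsIntegral : ℚ → Set
IsIntegral x = ∃[ k ] x ≡ toℚ k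

toℚ-integral : ∀ k → IsIntegral (toℚ k)
toℚ-integral k = k , refl

ℚ[]-integral : ∀ n → IsIntegral ℚ[ n ]
ℚ[]-integral n = toℚ-integral (+ n)

integral-+ : ∀ {x y} → IsIntegral x → IsIntegral y → IsIntegral (x + y)
integral-+ (a , refl) (b , refl) = a ℤ.+ b , sym (toℚ-+ a b)

integral-* : ∀ {x y} → IsIntegral x → IsIntegral y → IsIntegral (x * y)
integral-* (a , refl) (b , refl) = a ℤ.* b , sym (toℚ-* a b)

integral-neg : ∀ {x} → IsIntegral x → IsIntegral (- x)
integral-neg (a , refl) = ℤ.- a , sym (toℚ-neg a)

integral-- : ∀ {x y} → IsIntegral x → IsIntegral y → IsIntegral (x - y)
integral-- ix iy = integral-+ ix (integral-neg iy)

integral-*-combination : ∀ t {d m n} x y → d ℕ.+ y ℕ.* n ≡ x ℕ.* m →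
  IsIntegral (t * ℚ[ m ]) → IsIntegral (t * ℚ[ n ]) → IsIntegral (t * ℚ[ d ])
integral-*-combination t {d} {m} {n} x y d+yn≡xm tm tn =
  subst IsIntegral (sym t*d≡) (integral-- (integral-* (ℚ[]-integral x) tm) (integral-* (ℚ[]-integral y) tn))
  where
  open ≡-Reasoning
  d+yn≡xm-in-ℚ : ℚ[ d ] + ℚ[ y ] * ℚ[ n ] ≡ ℚ[ x ] * ℚ[ m ]
  d+yn≡xm-in-ℚ = begin
    ℚ[ d ] + ℚ[ y ] * ℚ[ n ]   ≡⟨ cong (λ z → ℚ[ d ] + z) (ℚ[]-* y n) ⟨
    ℚ[ d ] + ℚ[ y ℕ.* n ]      ≡⟨ ℚ[]-+ d (y ℕ.* n) ⟨
    ℚ[ d ℕ.+ y ℕ.* n ]         ≡⟨ cong ℚ[_] d+yn≡xm ⟩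
    ℚ[ x ℕ.* m ]               ≡⟨ ℚ[]-* x m ⟩
    ℚ[ x ] * ℚ[ m ]            ∎
  shift : ∀ t d y n → t * d ≡ t * (d + y * n) - y * (t * n)
  shift = solve-∀ ℚ-ring
  reassoc : ∀ t x m → t * (x * m) ≡ x * (t * m)
  reassoc = solve-∀ ℚ-ring
  t*d≡ : t * ℚ[ d ] ≡ ℚ[ x ] * (t * ℚ[ m ]) - ℚ[ y ] * (t * ℚ[ n ])
  t*d≡ = begin
    t * ℚ[ d ]                                              ≡⟨ shift t ℚ[ d ] ℚ[ y ] ℚ[ n ] ⟩
    t * (ℚ[ d ] + ℚ[ y ] * ℚ[ n ]) - ℚ[ y ] * (t * ℚ[ n ])  ≡⟨ cong (λ z → t * z - ℚ[ y ] * (t * ℚ[ n ])) d+yn≡xm-in-ℚ ⟩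
    t * (ℚ[ x ] * ℚ[ m ]) - ℚ[ y ] * (t * ℚ[ n ])           ≡⟨ cong (_- ℚ[ y ] * (t * ℚ[ n ])) (reassoc t ℚ[ x ] ℚ[ m ]) ⟩
    ℚ[ x ] * (t * ℚ[ m ]) - ℚ[ y ] * (t * ℚ[ n ])           ∎

integral-*-gcd : ∀ t m n → IsIntegral (t * ℚ[ m ]) → IsIntegral (t * ℚ[ n ]) → IsIntegral (t * ℚ[ gcd m n ])
integral-*-gcd t m n tm tn with Bézout.identity (gcd-GCD m n)
... | Bézout.+- x y eq = integral-*-combination t x y eq tm tn
... | Bézout.-+ x y eq = integral-*-combination t y x eq tn tm

integral-*-gcdOutside : ∀ {m} (T : Subset m) (g : Fin m → ℕ) t →
  (∀ j → lookup T j ≡ false → IsIntegral (t * ℚ[ g j ])) → IsIntegral (t * ℚ[ gcdOutside T g ])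
integral-*-gcdOutside {m} T g t tg = go (allFin m)
  where
  go : ∀ l → IsIntegral (t * ℚ[ foldr (λ j acc → if lookup T j then acc else gcd (g j) acc) 0 l ])
  go []      = + 0 , *-zeroʳ t
  go (j ∷ l) with lookup T j in j∉T
  ... | true  = go l
  ... | false = integral-*-gcd t (g j) _ (tg j j∉T) (go l)

infix 4 _≡±_modℤ

_≡±_modℤ : ℚ → ℚ → Set
x ≡± y modℤ = IsIntegral (x - y) ⊎ IsIntegral (x + y)

≡±modℤ-intro : ∀ {x y w n} → IsIntegral (x + y * toℚ w) → w ≡ + n ⊎ w ≡ ℤ.- + n → x ≡± y * ℚ[ n ] modℤ
≡±modℤ-intro x+yw (inj₁ refl) = inj₂ x+yw
≡±modℤ-intro {x} {y} {n = n} x+yw (inj₂ refl) =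
  inj₁ (subst IsIntegral (cong (λ z → x + z) (trans (cong (y *_) (toℚ-neg (+ n))) (sym (neg-distribʳ-* y ℚ[ n ])))) x+yw)

0≡±modℤ⇒integral : ∀ {y} → 0ℚ ≡± y modℤ → IsIntegral y
0≡±modℤ⇒integral {y} (inj₁ 0-y) = subst IsIntegral (negate-difference y) (integral-neg 0-y)
  where
  negate-difference : ∀ y → - (0ℚ - y) ≡ y
  negate-difference = solve-∀ ℚ-ring
0≡±modℤ⇒integral {y} (inj₂ 0+y) = subst IsIntegral (+-identityˡ y) 0+y

≡±modℤ-*-integral : ∀ {x t m d} → x ≡± t * m modℤ → IsIntegral m → IsIntegral d → IsIntegral (t * d) →
  IsIntegral (x * d)
≡±modℤ-*-integral {x} {t} {m} {d} (inj₁ x-tm) im id td =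
  subst IsIntegral (sym (split x t m d)) (integral-+ (integral-* x-tm id) (integral-* im td))
  where
  split : ∀ x t m d → x * d ≡ (x - t * m) * d + m * (t * d)
  split = solve-∀ ℚ-ring
≡±modℤ-*-integral {x} {t} {m} {d} (inj₂ x+tm) im id td =
  subst IsIntegral (sym (split x t m d)) (integral-- (integral-* x+tm id) (integral-* im td))
  where
  split : ∀ x t m d → x * d ≡ (x + t * m) * d - m * (t * d)
  split = solve-∀ ℚ-ring

∑ : ℕ → (ℕ → ℚ) → ℚ
∑ zero    F = 0ℚ
∑ (suc m) F = F 0 + ∑ m (F ∘ suc)

syntax ∑ m (λ k → x) = ∑[ k < m ] x

∑-cong : ∀ m {F G} → (∀ k → k < m → F k ≡ G k) → ∑ m F ≡ ∑ m G
∑-cong zero    F≡G = refl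
∑-cong (suc m) F≡G = cong₂ _+_ (F≡G 0 (s≤s z≤n)) (∑-cong m (λ k k<m → F≡G (suc k) (s≤s k<m)))

∑-zero : ∀ m {F} → (∀ k → F k ≡ 0ℚ) → ∑ m F ≡ 0ℚ
∑-zero zero    F≡0 = refl
∑-zero (suc m) F≡0 = trans (cong₂ _+_ (F≡0 0) (∑-zero m (F≡0 ∘ suc))) (+-identityʳ 0ℚ)

∑-last : ∀ m F → ∑ (suc m) F ≡ ∑ m F + F m
∑-last zero    F = +-comm (F 0) 0ℚ
∑-last (suc m) F = trans (cong (λ z → F 0 + z) (∑-last m (F ∘ suc))) (sym (+-assoc (F 0) _ _))

∑-split : ∀ m n F → ∑ (m ℕ.+ n) F ≡ ∑ m F + ∑[ k < n ] F (m ℕ.+ k)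
∑-split zero    n F = sym (+-identityˡ _)
∑-split (suc m) n F = trans (cong (λ z → F 0 + z) (∑-split m n (F ∘ suc))) (sym (+-assoc (F 0) _ _))

∑-neg : ∀ m F → ∑[ k < m ] (- F k) ≡ - ∑ m F
∑-neg zero    F = refl
∑-neg (suc m) F = trans (cong (λ z → - F 0 + z) (∑-neg m (F ∘ suc))) (sym (neg-distrib-+ (F 0) _))

∑-combination : ∀ m F c G → ∑[ k < m ] (F k - c * G k) ≡ ∑ m F - c * ∑ m G
∑-combination zero    F c G = sym (vanish c)
  where
  vanish : ∀ c → 0ℚ - c * 0ℚ ≡ 0ℚ
  vanish = solve-∀ ℚ-ring
∑-combination (suc m) F c G =
  trans (cong (λ z → F 0 - c * G 0 + z) (∑-combination m (F ∘ suc) c (G ∘ suc)))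
        (regroup (F 0) (G 0) c (∑ m (F ∘ suc)) (∑ m (G ∘ suc)))
  where
  regroup : ∀ f g c Σf Σg → f - c * g + (Σf - c * Σg) ≡ f + Σf - c * (g + Σg)
  regroup = solve-∀ ℚ-ring

∑-δ : ∀ m x F → x < m → ∑[ k < m ] (F k * toℚ (if k ≡ᵇ x then + 1 else + 0)) ≡ F x
∑-δ (suc m) zero F _ = begin
  F 0 * 1ℚ + ∑[ k < m ] (F (suc k) * 0ℚ)   ≡⟨ cong₂ _+_ (*-identityʳ (F 0)) (∑-zero m (λ k → *-zeroʳ (F (suc k)))) ⟩
  F 0 + 0ℚ                                 ≡⟨ +-identityʳ (F 0) ⟩
  F 0                                      ∎
  where open ≡-Reasoning
∑-δ (suc m) (suc x) F (s≤s x<m) = begin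
  F 0 * 0ℚ + ∑[ k < m ] (F (suc k) * toℚ (if k ≡ᵇ x then + 1 else + 0))
    ≡⟨ cong₂ _+_ (*-zeroʳ (F 0)) (∑-δ m x (λ k → F (suc k)) x<m) ⟩
  0ℚ + F (suc x)                                                          ≡⟨ +-identityˡ (F (suc x)) ⟩
  F (suc x)                                                               ∎
  where open ≡-Reasoning

∑-integral : ∀ m F → (∀ k → k < m → IsIntegral (F k)) → IsIntegral (∑ m F)
∑-integral zero    F _  = toℚ-integral (+ 0)
∑-integral (suc m) F iF = integral-+ (iF 0 (s≤s z≤n)) (∑-integral m (F ∘ suc) (λ k k<m → iF (suc k) (s≤s k<m)))

foldr-tabulate≡∑ : ∀ {X : Set} m (g : Fin m → X) (φ : X → ℚ → ℚ) (F : ℕ → ℚ) →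
  (∀ i acc → φ (g i) acc ≡ F (toℕ i) + acc) → foldr φ 0ℚ (tabulate g) ≡ ∑ m F
foldr-tabulate≡∑ zero    g φ F φ≡F = refl
foldr-tabulate≡∑ (suc m) g φ F φ≡F =
  trans (cong (φ (g Fin.zero)) (foldr-tabulate≡∑ m (g ∘ Fin.suc) φ (F ∘ suc) (φ≡F ∘ Fin.suc)))
        (φ≡F Fin.zero _)

sumOver≡∑ : ∀ {m} (T : Subset m) (f : Fin m → ℚ) (F : ℕ → ℚ) →
  (∀ i → (if lookup T i then f i else 0ℚ) ≡ F (toℕ i)) → sumOver T f ≡ ∑ m F
sumOver≡∑ {m} T f F f≡F = foldr-tabulate≡∑ m id _ F step
  where
  step : ∀ i acc → (if lookup T i then f i + acc else acc) ≡ F (toℕ i) + acc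
  step i acc with lookup T i | f≡F i
  ... | true  | fi≡Fi = cong (_+ acc) fi≡Fi
  ... | false | 0≡Fi  = trans (sym (+-identityˡ acc)) (cong (_+ acc) 0≡Fi)

ℚ[]-foldr : ∀ {X : Set} (h : X → ℕ) (l : List X) →
  ℚ[ foldr (λ j acc → h j ℕ.+ acc) 0 l ] ≡ foldr (λ j acc → ℚ[ h j ] + acc) 0ℚ l
ℚ[]-foldr h []      = refl
ℚ[]-foldr h (j ∷ l) = trans (ℚ[]-+ (h j) _) (cong (λ z → ℚ[ h j ] + z) (ℚ[]-foldr h l))

at-toℕ : ∀ {m} (f : Fin m → ℕ) i → at f (toℕ i) ≡ f i
at-toℕ {m} f i with toℕ i ℕ.<? m
... | yes i<m = cong f (fromℕ<-toℕ i i<m)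
... | no  i≮m = ⊥-elim (i≮m (toℕ<n i))

ℚ[]-sumℕ : ∀ {m} (f : Fin m → ℕ) → ℚ[ sumℕ f ] ≡ ∑[ k < m ] ℚ[ at f k ]
ℚ[]-sumℕ {m} f = trans (ℚ[]-foldr f (allFin m))
  (foldr-tabulate≡∑ m id _ _ (λ i acc → cong (λ n → ℚ[ n ] + acc) (sym (at-toℕ f i))))

extend : ∀ {X : Set} {m} → X → (Fin m → X) → ℕ → X
extend {m = m} d f k with k ℕ.<? m
... | yes k<m = f (fromℕ< k<m)
... | no  _   = d

extend-toℕ : ∀ {X : Set} {m} (d : X) (f : Fin m → X) i → extend d f (toℕ i) ≡ f i
extend-toℕ {m = m} d f i with toℕ i ℕ.<? m
... | yes i<m = cong f (fromℕ<-toℕ i i<m)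
... | no  i≮m = ⊥-elim (i≮m (toℕ<n i))

if-T : ∀ {X : Set} {b} {x y : X} → T b → (if b then x else y) ≡ x
if-T {b = true} _ = refl

if-¬T : ∀ {X : Set} {b} {x y : X} → ¬ T b → (if b then x else y) ≡ y
if-¬T {b = false} _  = refl
if-¬T {b = true}  ¬t = ⊥-elim (¬t _)

if-signed : ∀ b m n →
  (if b then + m else ℤ.- + n) ≡ + (if b then m else n) ⊎
  (if b then + m else ℤ.- + n) ≡ ℤ.- + (if b then m else n)
if-signed true  m n = inj₁ refl
if-signed false m n = inj₂ refl

suc[m+n]≰ᵇm : ∀ m n → ¬ T (suc (m ℕ.+ n) ≤ᵇ m)
suc[m+n]≰ᵇm m n h = ℕ.m+n≮m m n (ℕ.≤ᵇ⇒≤ (suc (m ℕ.+ n)) m h)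

-- α k is the coefficient of e_k (zero off T), t = α n, ν c the c-th coordinate of v,
-- and w c the (c+1)-st coordinate of e_n.
module Expansion (r' s' : ℕ) (p : Fin (suc r') → ℕ) (q : Fin (suc s') → ℕ)
  (qₛ≡1 : q (fromℕ s') ≡ 1) (∑p≡∑q : sumℕ p ≡ sumℕ q)
  (T : Subset (suc (dim r' s'))) (v : Fin (dim r' s') → ℤ) (a : Fin (suc (dim r' s')) → ℚ)
  (v≡∑ae : ∀ c → toℚ (v c) ≡ sumOver T (λ j → a j * toℚ (e r' s' p q j c))) where

  N M : ℕ
  N = dim r' s'
  M = r' ℕ.+ s'

  N≡1+M : N ≡ suc M
  N≡1+M = ℕ.+-suc r' s'

  α : ℕ → ℚ
  α = extend 0ℚ (λ j → if lookup T j then a j else 0ℚ)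

  t : ℚ
  t = α N

  ν : ℕ → ℚ
  ν c = toℚ (extend (+ 0) v c)

  w : ℕ → ℤ
  w c = if suc c ≤ᵇ r' then + at p c else ℤ.- + at q (suc c ∸ suc r')

  Pℚ : ℕ → ℚ
  Pℚ k = ℚ[ Pℕ r' s' p q k ]

  ν-integral : ∀ c → IsIntegral (ν c)
  ν-integral c = toℚ-integral (extend (+ 0) v c)

  α-inside : ∀ j → lookup T j ≡ true → α (toℕ j) ≡ a j
  α-inside j j∈T = trans (extend-toℕ 0ℚ _ j) (cong (λ b → if b then a j else 0ℚ) j∈T)

  α-outside : ∀ j → lookup T j ≡ false → α (toℕ j) ≡ 0ℚ
  α-outside j j∉T = trans (extend-toℕ 0ℚ _ j) (cong (λ b → if b then a j else 0ℚ) j∉T)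

  ν≡∑αe : ∀ c → c < N → ν c ≡ ∑[ k < suc N ] (α k * toℚ (eℕ r' s' p q k c))
  ν≡∑αe c c<N = begin
    ν c                                             ≡⟨ cong (toℚ ∘ extend (+ 0) v) (toℕ-fromℕ< c<N) ⟨
    toℚ (extend (+ 0) v (toℕ i))                    ≡⟨ cong toℚ (extend-toℕ (+ 0) v i) ⟩
    toℚ (v i)                                       ≡⟨ v≡∑ae i ⟩
    sumOver T (λ j → a j * toℚ (e r' s' p q j i))   ≡⟨ sumOver≡∑ T _ (λ k → α k * toℚ (eℕ r' s' p q k c)) summand ⟩
    ∑[ k < suc N ] (α k * toℚ (eℕ r' s' p q k c))   ∎
    where
    open ≡-Reasoning
    i = fromℕ< c<N
    summand : ∀ j → (if lookup T j then a j * toℚ (e r' s' p q j i) else 0ℚ) ≡ α (toℕ j) * toℚ (eℕ r' s' p q (toℕ j) c)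
    summand j rewrite extend-toℕ 0ℚ (λ j → if lookup T j then a j else 0ℚ) j | toℕ-fromℕ< c<N with lookup T j
    ... | true  = refl
    ... | false = sym (*-zeroˡ (toℚ (eℕ r' s' p q (toℕ j) c)))

  ν-zero : ν 0 ≡ ∑[ k < suc N ] α k
  ν-zero = trans (ν≡∑αe 0 (subst (0 <_) (sym N≡1+M) (s≤s z≤n))) (∑-cong (suc N) (λ k _ → *-identityʳ (α k)))

  ν-suc : ∀ c → suc c < N → ν (suc c) ≡ α (suc c) + t * toℚ (w c)
  ν-suc c 1+c<N = begin
    ν (suc c)                                       ≡⟨ ν≡∑αe (suc c) 1+c<N ⟩
    ∑[ k < suc N ] (α k * E k)                      ≡⟨ ∑-last N (λ k → α k * E k) ⟩
    ∑[ k < N ] (α k * E k) + t * E N                ≡⟨ cong₂ _+_ (∑-cong N off-diagonal) last-entry ⟩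
    ∑[ k < N ] (α k * δ k) + t * toℚ (w c)          ≡⟨ cong (_+ t * toℚ (w c)) (∑-δ N (suc c) α 1+c<N) ⟩
    α (suc c) + t * toℚ (w c)                       ∎
    where
    open ≡-Reasoning
    E δ : ℕ → ℚ
    E k = toℚ (eℕ r' s' p q k (suc c))
    δ k = toℚ (if k ≡ᵇ suc c then + 1 else + 0)
    off-diagonal : ∀ k → k < N → α k * E k ≡ α k * δ k
    off-diagonal k k<N = cong (λ z → α k * toℚ z) (if-¬T (λ k≡N → ℕ.<⇒≢ k<N (ℕ.≡ᵇ⇒≡ k N k≡N)))
    last-entry : t * E N ≡ t * toℚ (w c)
    last-entry = cong (λ z → t * toℚ z) (if-T (ℕ.≡⇒≡ᵇ N N refl))

  α≡ν-tw : ∀ c → suc c < N → α (suc c) ≡ ν (suc c) - t * toℚ (w c)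
  α≡ν-tw c 1+c<N = trans (add-sub (α (suc c)) (t * toℚ (w c))) (cong (_- t * toℚ (w c)) (sym (ν-suc c 1+c<N)))
    where
    add-sub : ∀ x y → x ≡ x + y - y
    add-sub = solve-∀ ℚ-ring

  at-q-last : at q s' ≡ 1
  at-q-last = trans (cong (at q) (sym (toℕ-fromℕ s'))) (trans (at-toℕ q (fromℕ s')) qₛ≡1)

  ∑p ∑q : ℚ
  ∑p = ∑[ i < r' ] ℚ[ at p i ]
  ∑q = ∑[ j < s' ] ℚ[ at q j ]

  ∑w : ∑[ c < M ] toℚ (w c) ≡ ∑p - ∑q
  ∑w = begin
    ∑[ c < M ] toℚ (w c)                                     ≡⟨ ∑-split r' s' (toℚ ∘ w) ⟩
    ∑[ c < r' ] toℚ (w c) + ∑[ j < s' ] toℚ (w (r' ℕ.+ j))   ≡⟨ cong₂ _+_ (∑-cong r' p-part) (∑-cong s' q-part) ⟩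
    ∑p + ∑[ j < s' ] (- ℚ[ at q j ])                         ≡⟨ cong (λ z → ∑p + z) (∑-neg s' (λ j → ℚ[ at q j ])) ⟩
    ∑p - ∑q                                                  ∎
    where
    open ≡-Reasoning
    p-part : ∀ c → c < r' → toℚ (w c) ≡ ℚ[ at p c ]
    p-part c c<r' = cong toℚ (if-T (ℕ.≤⇒≤ᵇ c<r'))
    q-part : ∀ j → j < s' → toℚ (w (r' ℕ.+ j)) ≡ - ℚ[ at q j ]
    q-part j _ = begin
      toℚ (w (r' ℕ.+ j))                  ≡⟨ cong toℚ (if-¬T (suc[m+n]≰ᵇm r' j)) ⟩
      toℚ (ℤ.- + at q (r' ℕ.+ j ∸ r'))    ≡⟨ cong (λ k → toℚ (ℤ.- + at q k)) (ℕ.m+n∸m≡n r' j) ⟩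
      toℚ (ℤ.- + at q j)                  ≡⟨ toℚ-neg (+ at q j) ⟩
      - ℚ[ at q j ]                       ∎

  ∑p+pᵣ≡∑q+1 : ∑p + Pℚ 0 ≡ ∑q + 1ℚ
  ∑p+pᵣ≡∑q+1 = begin
    ∑p + Pℚ 0                     ≡⟨ ∑-last r' (λ i → ℚ[ at p i ]) ⟨
    ∑[ i < suc r' ] ℚ[ at p i ]   ≡⟨ ℚ[]-sumℕ p ⟨
    ℚ[ sumℕ p ]                   ≡⟨ cong ℚ[_] ∑p≡∑q ⟩
    ℚ[ sumℕ q ]                   ≡⟨ ℚ[]-sumℕ q ⟩
    ∑[ j < suc s' ] ℚ[ at q j ]   ≡⟨ ∑-last s' (λ j → ℚ[ at q j ]) ⟩
    ∑q + ℚ[ at q s' ]             ≡⟨ cong (λ n → ∑q + ℚ[ n ]) at-q-last ⟩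
    ∑q + 1ℚ                       ∎
    where open ≡-Reasoning

  ν-zero-expanded : ν 0 ≡ α 0 + (∑[ c < M ] ν (suc c) - t * (∑p - ∑q)) + t
  ν-zero-expanded = begin
    ν 0                                                ≡⟨ ν-zero ⟩
    ∑[ k < suc N ] α k                                 ≡⟨ ∑-last N α ⟩
    ∑[ k < N ] α k + t                                 ≡⟨ cong (λ n → ∑ n α + t) N≡1+M ⟩
    α 0 + ∑[ c < M ] α (suc c) + t                     ≡⟨ cong (λ z → α 0 + z + t) (∑-cong M α≡ν-tw′) ⟩
    α 0 + ∑[ c < M ] (ν (suc c) - t * toℚ (w c)) + t
                                                       ≡⟨ cong (λ z → α 0 + z + t) (∑-combination M (ν ∘ suc) t (toℚ ∘ w)) ⟩
    α 0 + (∑[ c < M ] ν (suc c) - t * ∑[ c < M ] toℚ (w c)) + t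
                                                       ≡⟨ cong (λ z → α 0 + (∑[ c < M ] ν (suc c) - t * z) + t) ∑w ⟩
    α 0 + (∑[ c < M ] ν (suc c) - t * (∑p - ∑q)) + t   ∎
    where
    open ≡-Reasoning
    α≡ν-tw′ : ∀ c → c < M → α (suc c) ≡ ν (suc c) - t * toℚ (w c)
    α≡ν-tw′ c c<M = α≡ν-tw c (subst (suc c <_) (sym N≡1+M) (s≤s c<M))

  α≡±tP-zero : α 0 ≡± t * Pℚ 0 modℤ
  α≡±tP-zero = inj₂ (subst IsIntegral (sym α₀+tpᵣ≡ν₀-Σν) (integral-- (ν-integral 0) Σν-integral))
    where
    open ≡-Reasoning
    Σν = ∑[ c < M ] ν (suc c)
    Σν-integral : IsIntegral Σν
    Σν-integral = ∑-integral M (ν ∘ suc) (λ c _ → ν-integral (suc c))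
    add-sub : ∀ x y → x ≡ y + x - y
    add-sub = solve-∀ ℚ-ring
    pᵣ≡ : Pℚ 0 ≡ ∑q + 1ℚ - ∑p
    pᵣ≡ = trans (add-sub (Pℚ 0) ∑p) (cong (_- ∑p) ∑p+pᵣ≡∑q+1)
    regroup : ∀ α₀ Σν t ∑p ∑q → α₀ + t * (∑q + 1ℚ - ∑p) ≡ α₀ + (Σν - t * (∑p - ∑q)) + t - Σν
    regroup = solve-∀ ℚ-ring
    α₀+tpᵣ≡ν₀-Σν : α 0 + t * Pℚ 0 ≡ ν 0 - Σν
    α₀+tpᵣ≡ν₀-Σν = begin
      α 0 + t * Pℚ 0                          ≡⟨ cong (λ z → α 0 + t * z) pᵣ≡ ⟩
      α 0 + t * (∑q + 1ℚ - ∑p)                ≡⟨ regroup (α 0) Σν t ∑p ∑q ⟩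
      α 0 + (Σν - t * (∑p - ∑q)) + t - Σν     ≡⟨ cong (_- Σν) ν-zero-expanded ⟨
      ν 0 - Σν                                ∎

  α≡±tP-suc : ∀ c → suc c < N → α (suc c) ≡± t * Pℚ (suc c) modℤ
  α≡±tP-suc c 1+c<N =
    ≡±modℤ-intro {α (suc c)} {t} (subst IsIntegral (ν-suc c 1+c<N) (ν-integral (suc c))) (if-signed (suc c ≤ᵇ r') _ _)

  α≡±tP-last : α N ≡± t * Pℚ N modℤ
  α≡±tP-last = inj₁ (+ 0 , (begin
    t - t * Pℚ N                  ≡⟨ cong (λ n → t - t * ℚ[ n ]) P-last ⟩
    t - t * 1ℚ                    ≡⟨ cong (λ z → t - z) (*-identityʳ t) ⟩
    t - t                         ≡⟨ +-inverseʳ t ⟩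
    0ℚ                            ∎))
    where
    open ≡-Reasoning
    P-last : Pℕ r' s' p q N ≡ 1
    P-last = begin
      Pℕ r' s' p q N              ≡⟨ cong (Pℕ r' s' p q) N≡1+M ⟩
      Pℕ r' s' p q (suc M)        ≡⟨ if-¬T (suc[m+n]≰ᵇm r' s') ⟩
      at q (M ∸ r')               ≡⟨ cong (at q) (ℕ.m+n∸m≡n r' s') ⟩
      at q s'                     ≡⟨ at-q-last ⟩
      1                           ∎

  α≡±tP : ∀ k → k < suc N → α k ≡± t * Pℚ k modℤ
  α≡±tP zero    _         = α≡±tP-zero
  α≡±tP (suc c) (s≤s k≤N) with suc c ℕ.<? N
  ... | yes 1+c<N = α≡±tP-suc c 1+c<N
  ... | no  1+c≮N = subst (λ k → α k ≡± t * Pℚ k modℤ) (sym (ℕ.≤-antisym k≤N (ℕ.≮⇒≥ 1+c≮N))) α≡±tP-last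

lemma5p3 : (r' s' : ℕ) (p : Fin (suc r') → ℕ) (q : Fin (suc s') → ℕ) →
    (∀ i → p i > 0) → (∀ j → q j > 0) →
    (∀ i j → p i ≢ q j) →
    q (fromℕ s') ≡ 1 →
    sumℕ p ≡ sumℕ q →
    (T : Subset (suc (dim r' s'))) → Nonempty T → (∃[ x ] x ∉ T) →
    (v : Fin (dim r' s') → ℤ) (a : Fin (suc (dim r' s')) → ℚ) →
    (∀ j → j ∈ T → 0ℚ ≤ a j) →
    (∀ c → toℚ (v c) ≡ sumOver T (λ j → a j * toℚ (e r' s' p q j c))) →
    ∀ j → j ∈ T → ∃[ k ] a j * toℚ (+ gcdOutside T (P r' s' p q)) ≡ toℚ k
lemma5p3 r' s' p q _ _ _ qₛ≡1 ∑p≡∑q T _ _ v a _ v≡∑ae j j∈T =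
  subst (λ x → IsIntegral (x * ℚ[ d ])) (α-inside j ([]=⇒lookup j∈T))
    (≡±modℤ-*-integral {α (toℕ j)} {t} (α≡±tP (toℕ j) (toℕ<n j))
      (ℚ[]-integral (Pℕ r' s' p q (toℕ j))) (ℚ[]-integral d) t*d-integral)
  where
  open Expansion r' s' p q qₛ≡1 ∑p≡∑q T v a v≡∑ae
  d : ℕ
  d = gcdOutside T (P r' s' p q)
  t*d-integral : IsIntegral (t * ℚ[ d ])
  t*d-integral = integral-*-gcdOutside T (P r' s' p q) t (λ i i∉T →
    0≡±modℤ⇒integral (subst (_≡± t * Pℚ (toℕ i) modℤ) (α-outside i i∉T) (α≡±tP (toℕ i) (toℕ<n i))))
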